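{- Let $\tau$ be a finite unary vocabulary and $\mathfrak{M}$ a $\tau$-model of size $n$. Let $T = \{\pi_1,\dots,\pi_\ell\}$ be the types realized in $\mathfrak{M}$, enumerated so that $|\pi_1|\leq\dots\leq|\pi_\ell|$. Then $C(\mathfrak{M}) \geq 3|\pi_{\ell-1}| - 3$.
   Context: A $\tau$-model of size $n$ has domain $\{1,\dots,n\}$ and interprets each unary symbol of $\tau$ as a subset. A $\tau$-type is a subset $\pi\subseteq\tau$; $|\pi|$ is the number of points of $\mathfrak{M}$ belonging to exactly the relations named in $\pi$. $\mathrm{FO}[\tau]$-formulas (atoms $x=y$, $P(x)$; $\neg,\lor,\land,\exists,\forall$) are in negation normal form; the size of a formula is the number of atomic formulas (negated or not), conjunctions, disjunctions and quantifiers, negations not counted. A sentence defines $\mathfrak{M}$ if among $\tau$-models of size $n$ exactly those isomorphic to $\mathfrak{M}$ satisfy it; $C(\mathfrak{M})$ is the minimum size of an $\mathrm{FO}[\tau]$-formula defining $\mathfrak{M}$. -}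

module Defs where

open import Data.Nat using (ℕ; suc; _+_)
open import Data.Fin using (Fin)
open import Data.Fin.Subset using (Subset)
open import Data.Vec using (lookup; tabulate)
open import Data.Vec.Properties using (≡-dec)
open import Data.Vec.Functional using (_∷_)
open import Data.Bool using (Bool; true; false)
open import Data.Bool.Properties renaming (_≟_ to _≟B_)
open import Data.List using (length; filter; allFin)
open import Data.Product using (Σ; _×_)
open import Data.Sum using (_⊎_)
open import Relation.Binary.PropositionalEquality using (_≡_; _≢_)
open import Function.Bundles using (_↔_; Inverse)

-- A finite unary vocabulary τ = {P_0,...,P_{k-1}} is represented by Fin k.
Model : ℕ → ℕ → Set
Model k n = Fin k → Subset n

TypeOf : ℕ → Set
TypeOf k = Subset k

typeOf : ∀ {k n} → Model k n → Fin n → TypeOf k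
typeOf M x = tabulate (λ P → lookup (M P) x)

card : ∀ {k n} → Model k n → TypeOf k → ℕ
card {k} {n} M π = length (filter (λ x → ≡-dec _≟B_ (typeOf M x) π) (allFin n))

-- FO[τ]-formulas in negation normal form with m free variables
-- (de Bruijn indices).
data Formula (k : ℕ) : ℕ → Set where
  eq   : ∀ {m} → Fin m → Fin m → Formula k m
  neq  : ∀ {m} → Fin m → Fin m → Formula k m
  rel  : ∀ {m} → Fin k → Fin m → Formula k m
  nrel : ∀ {m} → Fin k → Fin m → Formula k m
  _∧_  : ∀ {m} → Formula k m → Formula k m → Formula k m
  _∨_  : ∀ {m} → Formula k m → Formula k m → Formula k m
  ex   : ∀ {m} → Formula k (suc m) → Formula k m
  all  : ∀ {m} → Formula k (suc m) → Formula k m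

Sentence : ℕ → Set
Sentence k = Formula k 0

size : ∀ {k m} → Formula k m → ℕ
size (eq _ _)   = 1
size (neq _ _)  = 1
size (rel _ _)  = 1
size (nrel _ _) = 1
size (φ ∧ ψ)    = suc (size φ + size ψ)
size (φ ∨ ψ)    = suc (size φ + size ψ)
size (ex φ)     = suc (size φ)
size (all φ)    = suc (size φ)

Sat : ∀ {k n m} → Model k n → Formula k m → (Fin m → Fin n) → Set
Sat M (eq i j)   ρ = ρ i ≡ ρ j
Sat M (neq i j)  ρ = ρ i ≢ ρ j
Sat M (rel P i)  ρ = lookup (M P) (ρ i) ≡ true
Sat M (nrel P i) ρ = lookup (M P) (ρ i) ≡ false
Sat M (φ ∧ ψ)    ρ = Sat M φ ρ × Sat M ψ ρ
Sat M (φ ∨ ψ)    ρ = Sat M φ ρ ⊎ Sat M ψ ρ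
Sat {n = n} M (ex φ)  ρ = Σ (Fin n) (λ a → Sat M φ (a ∷ ρ))
Sat {n = n} M (all φ) ρ = (a : Fin n) → Sat M φ (a ∷ ρ)

emptyEnv : ∀ {n} → Fin 0 → Fin n
emptyEnv ()

_⊨_ : ∀ {k n} → Model k n → Sentence k → Set
M ⊨ φ = Sat M φ emptyEnv

Iso : ∀ {k n} → Model k n → Model k n → Set
Iso {k} {n} M M' = Σ (Fin n ↔ Fin n) (λ f →
  (P : Fin k) (x : Fin n) → lookup (M P) x ≡ lookup (M' P) (Inverse.to f x))

Defines : ∀ {k n} → Sentence k → Model k n → Set
Defines {k} {n} φ M = (M' : Model k n) → ((M' ⊨ φ → Iso M M') × (Iso M M' → M' ⊨ φ))

{-# OPTIONS --safe #-}
-- Let A and B be the two most frequent types, |A| = β + 2 ≤ |B|, and let M′ be M with one point of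
-- type A retyped to B. Then M′ ≇ M, yet each model realises every type at least min(c, β + 1) times,
-- where c is the count in the other model. A back-and-forth argument shows that no sentence in
-- which every quantified variable is linked, through the graph of equality atoms, to at most β
-- variables in scope can separate two such models; as only a contradiction is sought, it runs in
-- the double-negation monad. The linking condition holds when the quantifier rank is at most
-- β + 1 and, since a connected graph on r + 1 vertices has at least r edges, when there are at most
-- β equality atoms. A defining sentence therefore has rank ≥ β + 2 and ≥ β + 1 equality atoms,
-- and its size is at least rank + 2 · (equality atoms) − 1 ≥ 3|A| − 3.
module Submission where

open import Defs
open import Data.Nat using (ℕ; suc; _*_; _∸_; _≤_)
open import Data.Fin using (Fin; inject₁; fromℕ) renaming (_≤_ to _≤ᶠ_)
open import Data.Product using (∃)
open import Relation.Binary.PropositionalEquality using (_≡_)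
open import Function.Definitions using (Injective)

open import Level using (0ℓ)
open import Data.Nat using (zero; _+_; _<_; _⊔_; z≤n; s≤s; _≤?_)
open import Data.Nat.Properties
  using (≤-refl; ≤-trans; <-irrefl; ≤-pred; <⇒≢; <⇒≱; ≮⇒≥; n<1+n; n≤1+n; m<n⇒m<1+n;
         +-suc; +-identityʳ; +-mono-≤; +-monoˡ-≤; +-monoʳ-≤; m≤m+n; *-monoʳ-≤; *-suc;
         m⊔n≤m+n; m≤m⊔n; m≤n⊔m; module ≤-Reasoning)
open import Data.Nat.Tactic.RingSolver using (solve-∀)
open import Data.Fin using (zero; suc)
open import Data.Fin.Properties using (_≟_; injective⇒≤; fromℕ≢inject₁; ≤fromℕ; sequence)
open import Data.Bool.Properties using () renaming (_≟_ to _≟B_)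
open import Data.Vec using (lookup; tabulate; _[_]≔_)
open import Data.Vec.Properties
  using (≡-dec; lookup∘tabulate; tabulate-cong; tabulate∘lookup; lookup∘update; lookup∘update′)
open import Data.Vec.Functional using () renaming (_∷_ to _∷ᶠ_)
open import Data.List as List using (List; []; _∷_; _++_; length; map; filter; allFin)
open import Data.List.Properties using (length-map; length-++; length-++-≤ˡ; length-++-≤ʳ)
open import Data.List.Membership.Propositional using (_∈_)
open import Data.List.Membership.Propositional.Properties
  using (∈-lookup; ∈-allFin; ∈-filter⁺; ∈-filter⁻; ∈-map⁺; ∈-++⁺ˡ; ∈-++⁺ʳ)
open import Data.List.Relation.Binary.Subset.Propositional using (_⊆_)
open import Data.List.Relation.Unary.All as All using (All; []; _∷_; sequenceM)
open import Data.List.Relation.Unary.All.Properties using () renaming (map⁺ to All-map⁺; map⁻ to All-map⁻)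
open import Data.List.Relation.Unary.Any using (here; there; index)
open import Data.List.Relation.Unary.Any.Properties using (lookup-index)
open import Data.List.Relation.Unary.Unique.Propositional using (Unique)
open import Data.List.Relation.Unary.Unique.Propositional.Properties using (allFin⁺; filter⁺)
  renaming (map⁺ to Unique-map⁺; map⁻ to Unique-map⁻)
open import Data.List.Relation.Unary.AllPairs using ([]; _∷_)
open import Data.Product using (_×_; _,_; proj₁; proj₂)
open import Data.Sum as Sum using (_⊎_; inj₁; inj₂; [_,_]′)
open import Data.Unit using (⊤)
open import Data.Empty using (⊥)
open import Effect.Monad using (RawMonad)
open import Function using (_∘_; case_of_; Inverse)
open import Function.Construct.Identity using (↔-id)
open import Relation.Binary.Core using (Rel)
open import Relation.Binary.Structures using (IsEquivalence)
open import Relation.Binary.Definitions using (Symmetric)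
open import Relation.Binary.PropositionalEquality using (refl; sym; trans; cong; subst; _≢_; module ≡-Reasoning)
import Relation.Binary.Construct.On as On
open import Relation.Binary.Construct.Closure.Equivalence as EqClosure using (EqClosure)
open import Relation.Binary.Construct.Closure.ReflexiveTransitive using (ε; _◅_; _◅◅_)
open import Relation.Binary.Construct.Closure.Symmetric using (fwd; bwd)
open import Relation.Nullary using (¬_; Dec; yes; no; contradiction)
open import Relation.Nullary.Decidable using (decidable-stable; ¬¬-excluded-middle)
open import Relation.Nullary.Negation using (¬¬-Monad)

open RawMonad (¬¬-Monad {0ℓ}) using (pure; _>>=_; _<$>_; rawApplicative)

module _ {A : Set} where

  ∈-nonempty : ∀ {xs : List A} → 0 < length xs → ∃ (_∈ xs)
  ∈-nonempty {x ∷ _} _ = x , here refl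

  unique-lookup-injective : ∀ {xs : List A} → Unique xs → Injective _≡_ _≡_ (List.lookup xs)
  unique-lookup-injective {_ ∷ _} (_ ∷ _) {zero} {zero} _ = refl
  unique-lookup-injective {_ ∷ _} (x∉ ∷ _) {zero} {suc j} x≡ =
    contradiction x≡ (All.lookup x∉ (∈-lookup j))
  unique-lookup-injective {_ ∷ _} (x∉ ∷ _) {suc i} {zero} ≡x =
    contradiction (sym ≡x) (All.lookup x∉ (∈-lookup i))
  unique-lookup-injective {_ ∷ _} (_ ∷ u) {suc i} {suc j} same = cong suc (unique-lookup-injective u same)

  unique-⊆⇒length≤ : ∀ {xs ys : List A} → Unique xs → xs ⊆ ys → length xs ≤ length ys
  unique-⊆⇒length≤ {xs} {ys} uniq xs⊆ys = injective⇒≤ position-injective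
    where
    position : Fin (length xs) → Fin (length ys)
    position i = index (xs⊆ys (∈-lookup i))
    position-injective : Injective _≡_ _≡_ position
    position-injective {i} {j} same = unique-lookup-injective uniq (begin
      List.lookup xs i             ≡⟨ lookup-index (xs⊆ys (∈-lookup i)) ⟩
      List.lookup ys (position i)  ≡⟨ cong (List.lookup ys) same ⟩
      List.lookup ys (position j)  ≡⟨ sym (lookup-index (xs⊆ys (∈-lookup j))) ⟩
      List.lookup xs j             ∎)
      where open ≡-Reasoning

module _ {I A : Set} {R : I → Set} where

  All-∃⇒map : ∀ {f : I → A} {xs} → All (λ x → ∃ λ i → R i × f i ≡ x) xs →
              ∃ λ is → All R is × map f is ≡ xs
  All-∃⇒map [] = [] , [] , refl
  All-∃⇒map {f} ((i , Ri , refl) ∷ images) =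
    let is , Ris , f[is]≡ = All-∃⇒map images in i ∷ is , Ri ∷ Ris , cong (f i ∷_) f[is]≡

  unique-map-transfer : ∀ {f g : I → A} {is} → All R is →
                        (∀ {i j} → R i → R j → f i ≡ f j → g i ≡ g j) →
                        Unique (map g is) → Unique (map f is)
  unique-map-transfer [] _ _ = []
  unique-map-transfer (Ri ∷ Ris) f⇒g (gi∉ ∷ uniq) =
    All-map⁺ (All.zipWith (λ (gi≢gj , Rj) fi≡fj → gi≢gj (f⇒g Ri Rj fi≡fj)) (All-map⁻ gi∉ , Ris))
    ∷ unique-map-transfer Ris f⇒g uniq

module _ {A : Set} where

  Connected : List (A × A) → Rel A 0ℓ
  Connected T = EqClosure (λ x y → (x , y) ∈ T)

  ReachableFrom : List (A × A) → List A → A → Set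
  ReachableFrom T S x = ∃ λ s → s ∈ S × Connected T s x

  connected-++ˡ : ∀ {T T′ x y} → Connected T x y → Connected (T ++ T′) x y
  connected-++ˡ = EqClosure.map ∈-++⁺ˡ

  connected-++ʳ : ∀ T {T′ x y} → Connected T′ x y → Connected (T ++ T′) x y
  connected-++ʳ T = EqClosure.map (∈-++⁺ʳ T)

  connected-[] : ∀ {s x} → Connected [] s x → s ≡ x
  connected-[] ε = refl
  connected-[] (fwd () ◅ _)
  connected-[] (bwd () ◅ _)

  connected-∷⁻ˡ : ∀ {u v T s x} → Connected ((u , v) ∷ T) s x →
                  Connected T s x ⊎ Connected T s u ⊎ Connected T s v
  connected-∷⁻ˡ ε = inj₁ ε
  connected-∷⁻ˡ (fwd (here refl) ◅ _) = inj₂ (inj₁ ε)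
  connected-∷⁻ˡ (bwd (here refl) ◅ _) = inj₂ (inj₂ ε)
  connected-∷⁻ˡ (fwd (there e) ◅ p) =
    Sum.map (fwd e ◅_) (Sum.map (fwd e ◅_) (fwd e ◅_)) (connected-∷⁻ˡ p)
  connected-∷⁻ˡ (bwd (there e) ◅ p) =
    Sum.map (bwd e ◅_) (Sum.map (bwd e ◅_) (bwd e ◅_)) (connected-∷⁻ˡ p)

  connected-∷⁻ʳ : ∀ {u v T s x} → Connected ((u , v) ∷ T) s x →
                  Connected T s x ⊎ Connected T u x ⊎ Connected T v x
  connected-∷⁻ʳ p = Sum.map flip (Sum.map flip flip) (connected-∷⁻ˡ (flip p))
    where
    flip : ∀ {T} → Symmetric (Connected T)
    flip = EqClosure.symmetric _

  -- Each edge of T adds at most one new vertex to what S reaches.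
  reachable-bound : ∀ T S {xs} → Unique xs → All (ReachableFrom T S) xs →
                    length xs ≤ length S + length T
  reachable-bound [] S {xs} uniq reach =
    subst (length xs ≤_) (sym (+-identityʳ _)) (unique-⊆⇒length≤ uniq (source ∘ All.lookup reach))
    where
    source : ∀ {x} → ReachableFrom [] S x → x ∈ S
    source (s , s∈S , s~x) = subst (_∈ S) (connected-[] s~x) s∈S
  reachable-bound ((u , v) ∷ T) S {xs} uniq reach = decidable-stable (_ ≤? _) λ ¬bound →
    ¬¬-excluded-middle λ where
      (yes S~u) → ¬bound (addSource (reachable-bound T (v ∷ S) uniq (All.map (throughˡ S~u) reach)))
      (no S≁u) → ¬¬-excluded-middle λ where
        (yes S~v) → ¬bound (addSource (reachable-bound T (u ∷ S) uniq (All.map (throughʳ S~v) reach)))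
        (no S≁v) → ¬bound (≤-trans (reachable-bound T S uniq (All.map (avoiding S≁u S≁v) reach))
                                    (+-monoʳ-≤ (length S) (n≤1+n (length T))))
    where
    addSource : ∀ {a} → a ≤ suc (length S + length T) → a ≤ length S + suc (length T)
    addSource {a} = subst (a ≤_) (sym (+-suc (length S) (length T)))
    throughˡ : ∀ {x} → ReachableFrom T S u →
               ReachableFrom ((u , v) ∷ T) S x → ReachableFrom T (v ∷ S) x
    throughˡ (s₀ , s₀∈S , s₀~u) (s , s∈S , s~x) with connected-∷⁻ʳ s~x
    ... | inj₁ s~x′ = s , there s∈S , s~x′
    ... | inj₂ (inj₁ u~x) = s₀ , there s₀∈S , s₀~u ◅◅ u~x
    ... | inj₂ (inj₂ v~x) = v , here refl , v~x
    throughʳ : ∀ {x} → ReachableFrom T S v →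
               ReachableFrom ((u , v) ∷ T) S x → ReachableFrom T (u ∷ S) x
    throughʳ (s₀ , s₀∈S , s₀~v) (s , s∈S , s~x) with connected-∷⁻ʳ s~x
    ... | inj₁ s~x′ = s , there s∈S , s~x′
    ... | inj₂ (inj₁ u~x) = u , here refl , u~x
    ... | inj₂ (inj₂ v~x) = s₀ , there s₀∈S , s₀~v ◅◅ v~x
    avoiding : ∀ {x} → ¬ ReachableFrom T S u → ¬ ReachableFrom T S v →
               ReachableFrom ((u , v) ∷ T) S x → ReachableFrom T S x
    avoiding S≁u S≁v (s , s∈S , s~x) with connected-∷⁻ˡ s~x
    ... | inj₁ s~x′ = s , s∈S , s~x′
    ... | inj₂ (inj₁ s~u) = contradiction (s , s∈S , s~u) S≁u
    ... | inj₂ (inj₂ s~v) = contradiction (s , s∈S , s~v) S≁v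

-- Variables are labelled by their de Bruijn level, which does not change under binders, so the
-- equality atoms of a formula and of all its subformulas form graphs on one set of labels.
level : ∀ {m} → Fin m → ℕ
level {suc m} zero = m
level {suc m} (suc i) = level i

level< : ∀ {m} (i : Fin m) → level i < m
level< {suc m} zero = n<1+n m
level< {suc m} (suc i) = m<n⇒m<1+n (level< i)

level-injective : ∀ {m} → Injective _≡_ _≡_ (level {m})
level-injective {suc m} {zero} {zero} _ = refl
level-injective {suc m} {zero} {suc j} m≡ = contradiction (sym m≡) (<⇒≢ (level< j))
level-injective {suc m} {suc i} {zero} ≡m = contradiction ≡m (<⇒≢ (level< i))
level-injective {suc m} {suc i} {suc j} same = cong suc (level-injective same)

LinkedToZero≤ : ∀ {m} → ℕ → Rel (Fin (suc m)) 0ℓ → Set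
LinkedToZero≤ β L = ∀ {is} → Unique is → All (L zero ∘ suc) is → length is ≤ β

module _ {k : ℕ} where

  edges : ∀ {m} → Formula k m → List (ℕ × ℕ)
  edges (eq i j) = (level i , level j) ∷ []
  edges (neq i j) = (level i , level j) ∷ []
  edges (rel _ _) = []
  edges (nrel _ _) = []
  edges (φ ∧ ψ) = edges φ ++ edges ψ
  edges (φ ∨ ψ) = edges φ ++ edges ψ
  edges (ex ψ) = edges ψ
  edges (all ψ) = edges ψ

  Linked : ∀ {m} → Formula k m → Rel (Fin m) 0ℓ
  Linked φ i j = Connected (edges φ) (level i) (level j)

  Linked-isEquivalence : ∀ {m} (φ : Formula k m) → IsEquivalence (Linked φ)
  Linked-isEquivalence φ = On.isEquivalence level (EqClosure.isEquivalence _)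

  quantifierRank : ∀ {m} → Formula k m → ℕ
  quantifierRank (φ ∧ ψ) = quantifierRank φ ⊔ quantifierRank ψ
  quantifierRank (φ ∨ ψ) = quantifierRank φ ⊔ quantifierRank ψ
  quantifierRank (ex ψ) = suc (quantifierRank ψ)
  quantifierRank (all ψ) = suc (quantifierRank ψ)
  quantifierRank _ = 0

  size-bound : ∀ {m} (φ : Formula k m) → quantifierRank φ + 2 * length (edges φ) ≤ suc (size φ)

  binary-size-bound : ∀ {m} (φ ψ : Formula k m) →
    quantifierRank φ ⊔ quantifierRank ψ + 2 * length (edges φ ++ edges ψ) ≤
    suc (suc (size φ + size ψ))
  binary-size-bound φ ψ = begin
    q₁ ⊔ q₂ + 2 * length (edges φ ++ edges ψ)
      ≡⟨ cong (λ e → q₁ ⊔ q₂ + 2 * e) (length-++ (edges φ)) ⟩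
    q₁ ⊔ q₂ + 2 * (e₁ + e₂)
      ≤⟨ +-monoˡ-≤ (2 * (e₁ + e₂)) (m⊔n≤m+n q₁ q₂) ⟩
    q₁ + q₂ + 2 * (e₁ + e₂)
      ≡⟨ regroup q₁ q₂ e₁ e₂ ⟩
    (q₁ + 2 * e₁) + (q₂ + 2 * e₂)
      ≤⟨ +-mono-≤ (size-bound φ) (size-bound ψ) ⟩
    suc (size φ) + suc (size ψ)
      ≡⟨ cong suc (+-suc (size φ) (size ψ)) ⟩
    suc (suc (size φ + size ψ))
      ∎
    where
    open ≤-Reasoning
    q₁ q₂ e₁ e₂ : ℕ
    q₁ = quantifierRank φ
    q₂ = quantifierRank ψ
    e₁ = length (edges φ)
    e₂ = length (edges ψ)
    regroup : ∀ a b c d → a + b + 2 * (c + d) ≡ (a + 2 * c) + (b + 2 * d)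
    regroup = solve-∀

  size-bound (eq _ _) = ≤-refl
  size-bound (neq _ _) = ≤-refl
  size-bound (rel _ _) = z≤n
  size-bound (nrel _ _) = z≤n
  size-bound (φ ∧ ψ) = binary-size-bound φ ψ
  size-bound (φ ∨ ψ) = binary-size-bound φ ψ
  size-bound (ex ψ) = s≤s (size-bound ψ)
  size-bound (all ψ) = s≤s (size-bound ψ)

  size-lower-bound : ∀ {m β} (φ : Formula k m) → suc (suc β) ≤ quantifierRank φ →
                     suc β ≤ length (edges φ) → 3 * suc (suc β) ∸ 3 ≤ size φ
  size-lower-bound {β = β} φ rank equalities =
    subst (_≤ size φ) (cong (_∸ 3) (sym (*-suc 3 (suc β))))
    (≤-pred (≤-trans (+-mono-≤ rank (*-monoʳ-≤ 2 equalities)) (size-bound φ)))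

  -- The back-and-forth answers a move on a quantified variable by looking only at the variables
  -- linked to it, so it needs at most β of them to keep room for a fresh element.
  Sparse : ∀ {m} → ℕ → Formula k m → Set
  Sparse β (φ ∧ ψ) = Sparse β φ × Sparse β ψ
  Sparse β (φ ∨ ψ) = Sparse β φ × Sparse β ψ
  Sparse β (ex ψ) = LinkedToZero≤ β (Linked ψ) × Sparse β ψ
  Sparse β (all ψ) = LinkedToZero≤ β (Linked ψ) × Sparse β ψ
  Sparse β _ = ⊤

  linkedToZero≤-scope : ∀ {m} {L : Rel (Fin (suc m)) 0ℓ} → LinkedToZero≤ m L
  linkedToZero≤-scope uniq _ = injective⇒≤ (unique-lookup-injective uniq)

  linkedToZero≤-edges : ∀ {m} (ψ : Formula k (suc m)) → LinkedToZero≤ (length (edges ψ)) (Linked ψ)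
  linkedToZero≤-edges {m} ψ {is} uniq links = ≤-pred (begin
    suc (length is)
      ≡⟨ cong suc (length-map level is) ⟨
    length (m ∷ map level is)
      ≤⟨ reachable-bound (edges ψ) (m ∷ []) labels-unique labels-reachable ⟩
    suc (length (edges ψ))
      ∎)
    where
    open ≤-Reasoning
    labels-unique : Unique (m ∷ map level is)
    labels-unique =
      All-map⁺ (All.universal (λ i → <⇒≢ (level< i) ∘ sym) is) ∷ Unique-map⁺ level-injective uniq
    labels-reachable : All (ReachableFrom (edges ψ) (m ∷ [])) (m ∷ map level is)
    labels-reachable = (m , here refl , ε) ∷ All-map⁺ (All.map (λ link → m , here refl , link) links)

  sparse-by-rank : ∀ {m β} (φ : Formula k m) → m + quantifierRank φ ≤ suc β → Sparse β φ

  quantified-sparse-by-rank : ∀ {m β} (ψ : Formula k (suc m)) →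
                              m + suc (quantifierRank ψ) ≤ suc β →
                              LinkedToZero≤ β (Linked ψ) × Sparse β ψ
  quantified-sparse-by-rank {m} {β} ψ bound =
    (λ uniq links → ≤-trans (linkedToZero≤-scope {L = Linked ψ} uniq links) m≤β) ,
    sparse-by-rank ψ bound′
    where
    bound′ : suc m + quantifierRank ψ ≤ suc β
    bound′ = subst (_≤ suc β) (+-suc m (quantifierRank ψ)) bound
    m≤β : m ≤ β
    m≤β = ≤-pred (≤-trans (m≤m+n (suc m) (quantifierRank ψ)) bound′)

  sparse-by-rank (eq _ _) _ = _
  sparse-by-rank (neq _ _) _ = _
  sparse-by-rank (rel _ _) _ = _
  sparse-by-rank (nrel _ _) _ = _
  sparse-by-rank {m} (φ ∧ ψ) bound =
    sparse-by-rank φ (≤-trans (+-monoʳ-≤ m (m≤m⊔n _ _)) bound) ,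
    sparse-by-rank ψ (≤-trans (+-monoʳ-≤ m (m≤n⊔m _ _)) bound)
  sparse-by-rank {m} (φ ∨ ψ) bound =
    sparse-by-rank φ (≤-trans (+-monoʳ-≤ m (m≤m⊔n _ _)) bound) ,
    sparse-by-rank ψ (≤-trans (+-monoʳ-≤ m (m≤n⊔m _ _)) bound)
  sparse-by-rank (ex ψ) = quantified-sparse-by-rank ψ
  sparse-by-rank (all ψ) = quantified-sparse-by-rank ψ

  sparse-by-equalities : ∀ {m β} (φ : Formula k m) → length (edges φ) ≤ β → Sparse β φ
  sparse-by-equalities (eq _ _) _ = _
  sparse-by-equalities (neq _ _) _ = _
  sparse-by-equalities (rel _ _) _ = _
  sparse-by-equalities (nrel _ _) _ = _
  sparse-by-equalities (φ ∧ ψ) bound =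
    sparse-by-equalities φ (≤-trans (length-++-≤ˡ (edges φ)) bound) ,
    sparse-by-equalities ψ (≤-trans (length-++-≤ʳ (edges ψ) {edges φ}) bound)
  sparse-by-equalities (φ ∨ ψ) bound =
    sparse-by-equalities φ (≤-trans (length-++-≤ˡ (edges φ)) bound) ,
    sparse-by-equalities ψ (≤-trans (length-++-≤ʳ (edges ψ) {edges φ}) bound)
  sparse-by-equalities (ex ψ) bound =
    (λ uniq links → ≤-trans (linkedToZero≤-edges ψ uniq links) bound) , sparse-by-equalities ψ bound
  sparse-by-equalities (all ψ) bound =
    (λ uniq links → ≤-trans (linkedToZero≤-edges ψ uniq links) bound) , sparse-by-equalities ψ bound

module _ {k n : ℕ} where

  elems : Model k n → TypeOf k → List (Fin n)
  elems N t = filter (λ x → ≡-dec _≟B_ (typeOf N x) t) (allFin n)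

  elems-unique : ∀ N t → Unique (elems N t)
  elems-unique N t = filter⁺ _ (allFin⁺ n)

  ∈-elems⁺ : ∀ N {t x} → typeOf N x ≡ t → x ∈ elems N t
  ∈-elems⁺ N {x = x} = ∈-filter⁺ _ (∈-allFin x)

  ∈-elems⁻ : ∀ N {t x} → x ∈ elems N t → typeOf N x ≡ t
  ∈-elems⁻ N {t} = proj₂ ∘ ∈-filter⁻ (λ x → ≡-dec _≟B_ (typeOf N x) t) {xs = allFin n}

  length≤card : ∀ N {t xs} → Unique xs → All (λ x → typeOf N x ≡ t) xs → length xs ≤ card N t
  length≤card N uniq typed = unique-⊆⇒length≤ uniq (∈-elems⁺ N ∘ All.lookup typed)

  card≤length : ∀ N {t ys} → (∀ {x} → typeOf N x ≡ t → x ∈ ys) → card N t ≤ length ys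
  card≤length N {t} cover = unique-⊆⇒length≤ (elems-unique N t) (cover ∘ ∈-elems⁻ N)

  sameType⇒sameRel : ∀ {N N′ : Model k n} {x y} P → typeOf N x ≡ typeOf N′ y →
                     lookup (N P) x ≡ lookup (N′ P) y
  sameType⇒sameRel {N} {N′} {x} {y} P same = begin
    lookup (N P) x           ≡⟨ lookup∘tabulate (λ P → lookup (N P) x) P ⟨
    lookup (typeOf N x) P    ≡⟨ cong (λ t → lookup t P) same ⟩
    lookup (typeOf N′ y) P   ≡⟨ lookup∘tabulate (λ P → lookup (N′ P) y) P ⟩
    lookup (N′ P) y          ∎
    where open ≡-Reasoning

  CountsCovered : ℕ → Model k n → Model k n → Set
  CountsCovered β N N′ = ∀ t → card N t ≤ card N′ t ⊎ β < card N′ t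

  PreservesEq : ∀ {m} → Rel (Fin m) 0ℓ → (Fin m → Fin n) → (Fin m → Fin n) → Set
  PreservesEq L ρ ρ′ = ∀ {i j} → L i j → ρ i ≡ ρ j → ρ′ i ≡ ρ′ j

  record Matching (N N′ : Model k n) {m} (L : Rel (Fin m) 0ℓ) (ρ ρ′ : Fin m → Fin n) : Set where
    field
      sameType : ∀ i → typeOf N (ρ i) ≡ typeOf N′ (ρ′ i)
      forth : PreservesEq L ρ ρ′
      back : PreservesEq L ρ′ ρ

  open Matching

  Matching-swap : ∀ {N N′ m} {L : Rel (Fin m) 0ℓ} {ρ ρ′} →
                  Matching N N′ L ρ ρ′ → Matching N′ N L ρ′ ρ
  Matching-swap match = record { sameType = sym ∘ sameType match ; forth = back match ; back = forth match }

  Matching-mono : ∀ {N N′ m} {L L′ : Rel (Fin m) 0ℓ} {ρ ρ′} →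
                  (∀ {i j} → L i j → L′ i j) → Matching N N′ L′ ρ ρ′ → Matching N N′ L ρ ρ′
  Matching-mono L⇒L′ match = record
    { sameType = sameType match ; forth = forth match ∘ L⇒L′ ; back = back match ∘ L⇒L′ }

  preservesEq-∷ : ∀ {m} {L : Rel (Fin (suc m)) 0ℓ} {ρ ρ′ a a′} → Symmetric L →
                  PreservesEq (λ i j → L (suc i) (suc j)) ρ ρ′ →
                  (∀ j → L zero (suc j) → a ≡ ρ j → a′ ≡ ρ′ j) →
                  PreservesEq L (a ∷ᶠ ρ) (a′ ∷ᶠ ρ′)
  preservesEq-∷ _ _ _ {zero} {zero} _ _ = refl
  preservesEq-∷ _ _ new {zero} {suc j} link = new j link
  preservesEq-∷ L-sym _ new {suc i} {zero} link same = sym (new i (L-sym link) (sym same))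
  preservesEq-∷ _ old _ {suc i} {suc j} link = old {i} {j} link

  matching-∷ : ∀ {N N′ m} {L : Rel (Fin (suc m)) 0ℓ} {ρ ρ′ a a′} → Symmetric L →
               Matching N N′ (λ i j → L (suc i) (suc j)) ρ ρ′ → typeOf N a ≡ typeOf N′ a′ →
               (∀ j → L zero (suc j) → a ≡ ρ j → a′ ≡ ρ′ j) →
               (∀ j → L zero (suc j) → a′ ≡ ρ′ j → a ≡ ρ j) →
               Matching N N′ L (a ∷ᶠ ρ) (a′ ∷ᶠ ρ′)
  matching-∷ L-sym match same new-forth new-back = record
    { sameType = λ { zero → same ; (suc i) → sameType match i }
    ; forth = λ {i j} → preservesEq-∷ L-sym (forth match) new-forth {i} {j}
    ; back = λ {i j} → preservesEq-∷ L-sym (back match) new-back {i} {j}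
    }

  -- If every element of N′ of the type of a were the image of an R-variable, these variables would
  -- name more than β elements, or more elements of that type in N (a among them) than exist in N′.
  fresh : ∀ {β N N′ m} {R : Fin m → Set} {ρ ρ′ : Fin m → Fin n} {a} →
          CountsCovered β N N′ →
          (∀ {is} → Unique is → All R is → length is ≤ β) →
          (∀ {i j} → R i → R j → ρ i ≡ ρ j → ρ′ i ≡ ρ′ j) →
          (∀ i → typeOf N (ρ i) ≡ typeOf N′ (ρ′ i)) →
          (∀ i → R i → ρ i ≢ a) →
          ¬ ¬ ∃ λ a′ → typeOf N′ a′ ≡ typeOf N a × (∀ i → R i → ρ′ i ≢ a′)
  fresh {β} {N} {N′} {R = R} {ρ} {ρ′} {a} covered few ρ⇒ρ′ types a-new no-a′ =
    sequenceM 0ℓ ¬¬-Monad (All.tabulate image) (separated ∘ All-∃⇒map)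
    where
    t : TypeOf k
    t = typeOf N a
    image : ∀ {x} → x ∈ elems N′ t → ¬ ¬ ∃ λ i → R i × ρ′ i ≡ x
    image x∈ not-image = no-a′ (_ , ∈-elems⁻ N′ x∈ , λ i Ri same → not-image (i , Ri , same))
    separated : (∃ λ is → All R is × map ρ′ is ≡ elems N′ t) → ⊥
    separated (is , Ris , ρ′[is]≡) = [ too-few , too-many ]′ (covered t)
      where
      ρ′[is]-unique : Unique (map ρ′ is)
      ρ′[is]-unique = subst Unique (sym ρ′[is]≡) (elems-unique N′ t)
      |is|≡ : length is ≡ card N′ t
      |is|≡ = trans (sym (length-map ρ′ is)) (cong length ρ′[is]≡)
      too-many : β < card N′ t → ⊥
      too-many β< = <⇒≱ β< (subst (_≤ β) |is|≡ (few (Unique-map⁻ ρ′[is]-unique) Ris))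
      ρ′-typed : All (λ i → typeOf N′ (ρ′ i) ≡ t) is
      ρ′-typed =
        All-map⁻ (subst (All (λ x → typeOf N′ x ≡ t)) (sym ρ′[is]≡) (All.tabulate (∈-elems⁻ N′)))
      a∷ρ[is]-unique : Unique (a ∷ map ρ is)
      a∷ρ[is]-unique = All-map⁺ (All.map (λ {i} Ri same → a-new i Ri (sym same)) Ris)
                       ∷ unique-map-transfer Ris ρ⇒ρ′ ρ′[is]-unique
      a∷ρ[is]-typed : All (λ x → typeOf N x ≡ t) (a ∷ map ρ is)
      a∷ρ[is]-typed =
        refl ∷ All-map⁺ (All.zipWith (λ {i} (_ , typed) → trans (types i) typed) (Ris , ρ′-typed))
      too-few : card N t ≤ card N′ t → ⊥
      too-few N≤N′ = <-irrefl |is|≡ (begin-strict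
        length is              <⟨ n<1+n (length is) ⟩
        suc (length is)        ≡⟨ cong suc (length-map ρ is) ⟨
        length (a ∷ map ρ is)  ≤⟨ length≤card N a∷ρ[is]-unique a∷ρ[is]-typed ⟩
        card N t               ≤⟨ N≤N′ ⟩
        card N′ t              ∎)
        where open ≤-Reasoning

  extend : ∀ {β N N′ m} {L : Rel (Fin (suc m)) 0ℓ} {ρ ρ′} →
           CountsCovered β N N′ → IsEquivalence L → LinkedToZero≤ β L →
           Matching N N′ (λ i j → L (suc i) (suc j)) ρ ρ′ →
           ∀ a → ¬ ¬ ∃ λ a′ → Matching N N′ L (a ∷ᶠ ρ) (a′ ∷ᶠ ρ′)
  extend {N = N} {N′} {L = L} {ρ} {ρ′} covered L-equiv few match a =
    ¬¬-excluded-middle {A = ∃ λ i → L zero (suc i) × ρ i ≡ a} >>= λ where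
      (yes (i , Ri , refl)) → pure (ρ′ i , matching-∷ {N} {N′} L-sym match (sameType match i)
        (λ j Rj → forth match (link Ri Rj)) (λ j Rj → back match (link Ri Rj)))
      (no a-new) → do
        a′ , same , a′-new ← fresh {N = N} {N′} covered few (λ Ri Rj → forth match (link Ri Rj))
                                   (sameType match) (λ i Ri ρi≡a → a-new (i , Ri , ρi≡a))
        pure (a′ , matching-∷ {N} {N′} L-sym match (sym same)
          (λ j Rj a≡ρj → contradiction (j , Rj , sym a≡ρj) a-new)
          (λ j Rj a′≡ρ′j → contradiction (sym a′≡ρ′j) (a′-new j Rj)))
    where
    open IsEquivalence L-equiv using () renaming (sym to L-sym; trans to L-trans)
    link : ∀ {i j} → L zero (suc i) → L zero (suc j) → L (suc i) (suc j)
    link Ri Rj = L-trans (L-sym Ri) Rj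

  preservation : ∀ {β N N′} → CountsCovered β N N′ → CountsCovered β N′ N →
                 ∀ {m} (φ : Formula k m) → Sparse β φ →
                 ∀ {ρ ρ′} → Matching N N′ (Linked φ) ρ ρ′ → Sat N φ ρ → ¬ ¬ Sat N′ φ ρ′
  preservation _ _ (eq i j) _ match s = pure (forth match (fwd (here refl) ◅ ε) s)
  preservation _ _ (neq i j) _ match s = pure (s ∘ back match (fwd (here refl) ◅ ε))
  preservation {N = N} {N′} _ _ (rel P i) _ match s =
    pure (trans (sym (sameType⇒sameRel {N} {N′} P (sameType match i))) s)
  preservation {N = N} {N′} _ _ (nrel P i) _ match s =
    pure (trans (sym (sameType⇒sameRel {N} {N′} P (sameType match i))) s)
  preservation c c′ (φ ∧ ψ) (φ-sparse , ψ-sparse) match (sφ , sψ) = do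
    sφ′ ← preservation c c′ φ φ-sparse (Matching-mono connected-++ˡ match) sφ
    sψ′ ← preservation c c′ ψ ψ-sparse (Matching-mono (connected-++ʳ (edges φ)) match) sψ
    pure (sφ′ , sψ′)
  preservation c c′ (φ ∨ ψ) (φ-sparse , _) match (inj₁ sφ) =
    inj₁ <$> preservation c c′ φ φ-sparse (Matching-mono connected-++ˡ match) sφ
  preservation c c′ (φ ∨ ψ) (_ , ψ-sparse) match (inj₂ sψ) =
    inj₂ <$> preservation c c′ ψ ψ-sparse (Matching-mono (connected-++ʳ (edges φ)) match) sψ
  preservation c c′ (ex ψ) (few , ψ-sparse) match (a , s) = do
    a′ , match′ ← extend c (Linked-isEquivalence ψ) few match a
    s′ ← preservation c c′ ψ ψ-sparse match′ s
    pure (a′ , s′)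
  preservation c c′ (all ψ) (few , ψ-sparse) match s = sequence rawApplicative λ a′ → do
    a , match′ ← extend c′ (Linked-isEquivalence ψ) few (Matching-swap match) a′
    preservation c c′ ψ ψ-sparse (Matching-swap match′) (s a)

  indistinguishable : ∀ {β N N′} → CountsCovered β N N′ → CountsCovered β N′ N →
                      (φ : Sentence k) → Sparse β φ → N ⊨ φ → ¬ ¬ (N′ ⊨ φ)
  indistinguishable c c′ φ sparse = preservation c c′ φ sparse
    record { sameType = λ () ; forth = λ { {()} } ; back = λ { {()} } }

retype : ∀ {k n} → Model k n → Fin n → TypeOf k → Model k n
retype M u B P = M P [ u ]≔ lookup B P

module _ {k n} (M : Model k n) (u : Fin n) (B : TypeOf k) where

  typeOf-retype-≡ : typeOf (retype M u B) u ≡ B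
  typeOf-retype-≡ =
    trans (tabulate-cong (λ P → lookup∘update u (M P) (lookup B P))) (tabulate∘lookup B)

  typeOf-retype-≢ : ∀ {x} → x ≢ u → typeOf (retype M u B) x ≡ typeOf M x
  typeOf-retype-≢ {x} x≢u = tabulate-cong (λ P → lookup∘update′ x≢u (M P) (lookup B P))

module _ {k n} (N N′ : Model k n) {u : Fin n}
         (agree : ∀ {x} → x ≢ u → typeOf N x ≡ typeOf N′ x) where

  card≤-untouched : ∀ {t} → typeOf N u ≢ t → card N t ≤ card N′ t
  card≤-untouched u≢t =
    card≤length N λ x:t → ∈-elems⁺ N′ (trans (sym (agree λ { refl → u≢t x:t })) x:t)

  card≤suc : ∀ {t} → card N t ≤ suc (card N′ t)
  card≤suc {t} = card≤length N {ys = u ∷ elems N′ t} λ {x} x:t → case x ≟ u of λ where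
    (yes refl) → here refl
    (no x≢u) → there (∈-elems⁺ N′ (trans (sym (agree x≢u)) x:t))

iso⇒card≤ : ∀ {k n} {N N′ : Model k n} → Iso N N′ → ∀ t → card N′ t ≤ card N t
iso⇒card≤ {N = N} {N′} (f , preserves) t =
  subst (card N′ t ≤_) (length-map to (elems N t)) (card≤length N′ covered)
  where
  open Inverse f
  covered : ∀ {y} → typeOf N′ y ≡ t → y ∈ map to (elems N t)
  covered {y} y:t = subst (_∈ map to (elems N t)) (strictlyInverseˡ y) (∈-map⁺ to (∈-elems⁺ N from-y:t))
    where
    open ≡-Reasoning
    from-y:t : typeOf N (from y) ≡ t
    from-y:t = begin
      typeOf N (from y)        ≡⟨ tabulate-cong (λ P → preserves P (from y)) ⟩
      typeOf N′ (to (from y))  ≡⟨ cong (typeOf N′) (strictlyInverseˡ y) ⟩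
      typeOf N′ y              ≡⟨ y:t ⟩
      t                        ∎

module _ {k n} (M : Model k n) {A B : TypeOf k} {β : ℕ}
         (A≢B : A ≢ B) (A≤B : card M A ≤ card M B) (|A| : card M A ≡ suc (suc β)) where

  private
    _≟ₜ_ : (t t′ : TypeOf k) → Dec (t ≡ t′)
    _≟ₜ_ = ≡-dec _≟B_

    u∈A : ∃ (_∈ elems M A)
    u∈A = ∈-nonempty (subst (0 <_) (sym |A|) (s≤s z≤n))

    u : Fin n
    u = proj₁ u∈A

    u:A : typeOf M u ≡ A
    u:A = ∈-elems⁻ M (proj₂ u∈A)

    M′ : Model k n
    M′ = retype M u B

    M′-agrees : ∀ {x} → x ≢ u → typeOf M′ x ≡ typeOf M x
    M′-agrees = typeOf-retype-≢ M u B

    u:B : typeOf M′ u ≡ B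
    u:B = typeOf-retype-≡ M u B

    type-B⇒≢u : ∀ {x} → typeOf M x ≡ B → x ≢ u
    type-B⇒≢u x:B refl = A≢B (trans (sym u:A) x:B)

    covered : CountsCovered β M M′
    covered t with t ≟ₜ A
    ... | yes refl = inj₂ (≤-pred (subst (_≤ suc (card M′ A)) |A| (card≤suc M M′ (sym ∘ M′-agrees))))
    ... | no t≢A = inj₁ (card≤-untouched M M′ (sym ∘ M′-agrees) λ u:t → t≢A (trans (sym u:t) u:A))

    covered′ : CountsCovered β M′ M
    covered′ t with t ≟ₜ B
    ... | yes refl = inj₂ (≤-trans (n≤1+n (suc β)) (subst (_≤ card M B) |A| A≤B))
    ... | no t≢B = inj₁ (card≤-untouched M′ M M′-agrees λ u:t → t≢B (trans (sym u:t) u:B))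

    M′-has-more-B : suc (card M B) ≤ card M′ B
    M′-has-more-B = length≤card M′
      (All.tabulate (λ x∈ u≡x → type-B⇒≢u (∈-elems⁻ M x∈) (sym u≡x)) ∷ elems-unique M B)
      (u:B ∷ All.tabulate (λ x∈ → let x:B = ∈-elems⁻ M x∈ in trans (M′-agrees (type-B⇒≢u x:B)) x:B))

    ¬iso : ¬ Iso M M′
    ¬iso iso = <⇒≱ M′-has-more-B (iso⇒card≤ {N = M} {M′} iso B)

  no-sparse-definition : ∀ {φ} → Defines φ M → ¬ Sparse β φ
  no-sparse-definition {φ} def sparse =
    indistinguishable covered covered′ φ sparse (proj₂ (def M) (↔-id _ , λ _ _ → refl))
      (¬iso ∘ proj₁ (def M′))

  defining-sentence-bounds : ∀ {φ} → Defines φ M →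
                             suc (suc β) ≤ quantifierRank φ × suc β ≤ length (edges φ)
  defining-sentence-bounds {φ} def =
    ≮⇒≥ (λ small → no-sparse-definition def (sparse-by-rank φ (≤-pred small))) ,
    ≮⇒≥ (λ few → no-sparse-definition def (sparse-by-equalities φ (≤-pred few)))

theorem4 : ∀ {k n} (M : Model k n) (m : ℕ) (π : Fin (suc (suc m)) → TypeOf k)
           → Injective _≡_ _≡_ π
           → (∀ i → 1 ≤ card M (π i))
           → (∀ σ → 1 ≤ card M σ → ∃ λ i → π i ≡ σ)
           → (∀ i j → i ≤ᶠ j → card M (π i) ≤ card M (π j))
           → (φ : Sentence k) → Defines φ M
           → 3 * card M (π (inject₁ (fromℕ m))) ∸ 3 ≤ size φ
-- Only the two largest types are used.
theorem4 M m π π-injective realized _ sorted φ def with card M (π (inject₁ (fromℕ m))) in |A|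
... | zero = contradiction (subst (1 ≤_) |A| (realized (inject₁ (fromℕ m)))) λ ()
... | suc zero = z≤n
... | suc (suc β) =
  let rank , equalities = defining-sentence-bounds M A≢B A≤B |A| def
  in size-lower-bound φ rank equalities
  where
  A≢B : π (inject₁ (fromℕ m)) ≢ π (fromℕ (suc m))
  A≢B = fromℕ≢inject₁ ∘ sym ∘ π-injective
  A≤B : card M (π (inject₁ (fromℕ m))) ≤ card M (π (fromℕ (suc m)))
  A≤B = sorted _ _ (≤fromℕ _)
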